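{- If $X$ is a prime permutation graph, then ${\rm Aut}(X)$ is isomorphic to a subgroup of $\mathbb{Z}_2^2$.
   Context: A permutation graph is a graph $X$ such that both $X$ and its complement $\overline X$ admit transitive orientations (orientations of the edges forming a transitive relation); equivalently, the intersection graph of segments joining two parallel lines. A module of $X$ is a set $M\subseteq V(X)$ such that every vertex outside $M$ is adjacent to all or to none of the vertices of $M$; $X$ is prime if its only modules are $V(X)$ and the singletons. -}

module Defs where

open import Data.Nat using (ℕ)
open import Data.Fin using (Fin)
open import Data.Fin.Permutation using (Permutation′; _⟨$⟩ʳ_; _∘ₚ_)
open import Data.Bool using (Bool; true; false; not; _xor_)
open import Data.Product using (Σ; _×_; _,_; ∃)
open import Data.Sum using (_⊎_)
open import Relation.Binary.PropositionalEquality using (_≡_; _≢_)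
open import Relation.Nullary using (¬_)

record Graph (n : ℕ) : Set where
  field
    adj   : Fin n → Fin n → Bool
    adj-sym   : ∀ i j → adj i j ≡ adj j i
    adj-irref : ∀ i → adj i i ≡ false
open Graph public

Edge : ∀ {n} → Graph n → Fin n → Fin n → Set
Edge X i j = adj X i j ≡ true

complement : ∀ {n} → Graph n → Graph n
complement {n} X = record { adj = cadj ; adj-sym = csym ; adj-irref = cirr }
  where
  open import Data.Fin using (_≟_)
  open import Relation.Nullary using (yes; no)
  open import Relation.Binary.PropositionalEquality using (refl; sym; cong)
  cadj : Fin n → Fin n → Bool
  cadj i j with i ≟ j
  ... | yes _ = false
  ... | no  _ = not (adj X i j)
  csym : ∀ i j → cadj i j ≡ cadj j i
  csym i j with i ≟ j | j ≟ i
  ... | yes _ | yes _ = refl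
  ... | yes p | no q = Data.Empty.⊥-elim (q (sym p)) where import Data.Empty
  ... | no p | yes q = Data.Empty.⊥-elim (p (sym q)) where import Data.Empty
  ... | no _ | no _ = cong not (Graph.adj-sym X i j)
  cirr : ∀ i → cadj i i ≡ false
  cirr i with i ≟ i
  ... | yes _ = refl
  ... | no p = Data.Empty.⊥-elim (p refl) where import Data.Empty

IsTransitiveOrientation : ∀ {n} → Graph n → (Fin n → Fin n → Bool) → Set
IsTransitiveOrientation {n} X O =
    (∀ i j → O i j ≡ true → Edge X i j)
  × (∀ i j → Edge X i j → (O i j ≡ true) ⊎ (O j i ≡ true))
  × (∀ i j → O i j ≡ true → O j i ≡ true → ⊥')
  × (∀ i j k → O i j ≡ true → O j k ≡ true → O i k ≡ true)
  where open import Data.Empty renaming (⊥ to ⊥')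

TransitivelyOrientable : ∀ {n} → Graph n → Set
TransitivelyOrientable {n} X = Σ (Fin n → Fin n → Bool) (IsTransitiveOrientation X)

IsPermutationGraph : ∀ {n} → Graph n → Set
IsPermutationGraph X = TransitivelyOrientable X × TransitivelyOrientable (complement X)

IsModule : ∀ {n} → Graph n → (Fin n → Bool) → Set
IsModule X M = ∀ v a b → M v ≡ false → M a ≡ true → M b ≡ true → adj X v a ≡ adj X v b

IsPrime : ∀ {n} → Graph n → Set
IsPrime X = ∀ M → IsModule X M →
  (∀ v → M v ≡ true) ⊎ (∀ a b → M a ≡ true → M b ≡ true → a ≡ b)

IsAut : ∀ {n} → Graph n → Permutation′ n → Set
IsAut X σ = ∀ i j → adj X (σ ⟨$⟩ʳ i) (σ ⟨$⟩ʳ j) ≡ adj X i j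

Aut : ∀ {n} → Graph n → Set
Aut {n} X = Σ (Permutation′ n) (IsAut X)

_∘ᴬ_ : ∀ {n} {X : Graph n} → Aut X → Aut X → Aut X
_∘ᴬ_ {X = X} (σ , p) (τ , q) = (σ ∘ₚ τ) , λ i j → Relation.Binary.PropositionalEquality.trans (q (σ ⟨$⟩ʳ i) (σ ⟨$⟩ʳ j)) (p i j)
  where import Relation.Binary.PropositionalEquality

Z₂² : Set
Z₂² = Bool × Bool

_⊕_ : Z₂² → Z₂² → Z₂²
(a , b) ⊕ (c , d) = (a xor c) , (b xor d)

-- Aut(X) is isomorphic to a subgroup of Z₂²: there is an injective group
-- homomorphism Aut(X) → Z₂² (equality in Aut(X) = pointwise equality of
-- the underlying permutations).
AutEmbedsInZ₂² : ∀ {n} → Graph n → Set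
AutEmbedsInZ₂² {n} X = Σ (Aut X → Z₂²) λ φ →
    (∀ σ τ → φ (_∘ᴬ_ {X = X} σ τ) ≡ φ σ ⊕ φ τ)
  × (∀ σ τ → φ σ ≡ φ τ → ∀ i → Data.Product.proj₁ σ ⟨$⟩ʳ i ≡ Data.Product.proj₁ τ ⟨$⟩ʳ i)
  where import Data.Product

module Submission where

-- Fix transitive orientations O of X and P of its complement.  The argument
-- is Gallai's theory of forcing.  The forcing closure of an edge, computed by
-- iterating one round of forcing until it stabilises, obeys an invariance
-- principle; in a prime graph it contains every edge, so a transitive
-- orientation of a prime graph is unique up to reversal.  Hence every
-- automorphism preserves or reverses O, which defines a homomorphism
-- Aut(X) → Z₂; the complement is prime too, so P gives a second one.  Finally
-- O ∪ P is a strict total order on the vertices, the two bits of an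
-- automorphism determine how it moves this order, and a permutation
-- preserving a finite linear order is the identity (it preserves ranks); so
-- the pair of bits is an injective homomorphism Aut(X) → Z₂².

open import Defs
open import Data.Nat using (ℕ; zero; suc; _+_; _*_; _≤_; _<_; z≤n; s≤s; _≤′_; ≤′-refl; ≤′-step)
open import Data.Nat.Properties
  using (≤-refl; ≤-trans; ≤-<-trans; +-mono-≤; +-mono-<-≤; +-suc; n≮n; <-irrefl; n≤1+n; ≤⇒≤′; _<?_; +-0-commutativeMonoid)
open import Algebra.Properties.CommutativeMonoid.Sum +-0-commutativeMonoid using (sum; sum-permute; sum-cong-≗)
open import Data.Fin using (Fin; zero; suc; _≟_)
open import Data.Fin.Properties using (any?)
open import Data.Fin.Permutation using (Permutation′; _⟨$⟩ʳ_; _⟨$⟩ˡ_; _∘ₚ_; inverseˡ; inverseʳ; flip)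
open import Data.Bool using (Bool; true; false; not; _∧_; _∨_; _xor_)
open import Data.Bool.Properties using (¬-not; not-injective; ∨-identityʳ; xor-assoc; xor-comm; not-distribˡ-xor)
  renaming (_≟_ to _≟ᵇ_)
open import Data.Product using (_×_; _,_; ∃-syntax; proj₁; proj₂)
open import Data.Sum using (_⊎_; inj₁; inj₂; swap)
open import Data.Empty using (⊥; ⊥-elim)
open import Function using (_⇔_; mk⇔; Equivalence; _$_; _∘_)
open import Function.Construct.Identity using (⇔-id)
open import Function.Construct.Composition using (_⇔-∘_)
open import Relation.Nullary using (Dec; yes; no; does)
open import Relation.Nullary.Decidable using (dec-true)
open import Relation.Binary.PropositionalEquality using (_≡_; _≢_; refl; sym; trans; cong; cong₂; subst)
open Relation.Binary.PropositionalEquality.≡-Reasoning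

clash : ∀ {A : Set} {b} → b ≡ true → b ≡ false → A
clash refl ()

∨-elim : ∀ a {b} → a ∨ b ≡ true → a ≡ true ⊎ b ≡ true
∨-elim true  h = inj₁ refl
∨-elim false h = inj₂ h

∨-introˡ : ∀ {a} b → a ≡ true → a ∨ b ≡ true
∨-introˡ b refl = refl

∨-introʳ : ∀ a {b} → b ≡ true → a ∨ b ≡ true
∨-introʳ true  h = refl
∨-introʳ false h = h

∧-elim : ∀ a {b} → a ∧ b ≡ true → a ≡ true × b ≡ true
∧-elim true h = refl , h

∧-intro : ∀ {a b} → a ≡ true → b ≡ true → a ∧ b ≡ true
∧-intro refl refl = refl

not-true : ∀ {b} → not b ≡ true → b ≡ false
not-true {false} h = refl

adj-flip : ∀ {n} (X : Graph n) {x y b} → adj X x y ≡ b → adj X y x ≡ b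
adj-flip X {x} {y} xy = trans (adj-sym X y x) xy

anyᵇ : ∀ {n} → (Fin n → Bool) → Bool
anyᵇ P = does (any? (λ i → P i ≟ᵇ true))

anyᵇ-intro : ∀ {n} (P : Fin n → Bool) i → P i ≡ true → anyᵇ P ≡ true
anyᵇ-intro P i p = dec-true (any? (λ i → P i ≟ᵇ true)) (i , p)

anyᵇ-elim : ∀ {n} (P : Fin n → Bool) → anyᵇ P ≡ true → ∃[ i ] P i ≡ true
anyᵇ-elim P h with any? (λ i → P i ≟ᵇ true)
... | yes witness = witness

indicator : Bool → ℕ
indicator true  = 1
indicator false = 0

indicator≤1 : ∀ b → indicator b ≤ 1
indicator≤1 true  = s≤s z≤n
indicator≤1 false = z≤n

indicator-mono : ∀ {a b} → (a ≡ true → b ≡ true) → indicator a ≤ indicator b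
indicator-mono {false} _ = z≤n
indicator-mono {true}  h rewrite h refl = ≤-refl

indicator-strict : ∀ {a b} → a ≡ false → b ≡ true → indicator a < indicator b
indicator-strict refl refl = s≤s z≤n

sum-mono : ∀ {m} (f g : Fin m → ℕ) → (∀ i → f i ≤ g i) → sum f ≤ sum g
sum-mono {zero}  f g f≤g = z≤n
sum-mono {suc m} f g f≤g = +-mono-≤ (f≤g zero) (sum-mono (λ i → f (suc i)) (λ i → g (suc i)) (λ i → f≤g (suc i)))

sum-strict : ∀ {m} (f g : Fin m → ℕ) → (∀ i → f i ≤ g i) → ∀ k → f k < g k → sum f < sum g
sum-strict {suc m} f g f≤g zero    fk<gk =
  +-mono-<-≤ fk<gk (sum-mono (λ i → f (suc i)) (λ i → g (suc i)) (λ i → f≤g (suc i)))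
sum-strict {suc m} f g f≤g (suc k) fk<gk =
  subst (_≤ sum g) (+-suc (f zero) _)
    (+-mono-≤ (f≤g zero) (sum-strict (λ i → f (suc i)) (λ i → g (suc i)) (λ i → f≤g (suc i)) k fk<gk))

sum-bound : ∀ {m} (f : Fin m → ℕ) b → (∀ i → f i ≤ b) → sum f ≤ m * b
sum-bound {zero}  f b f≤b = z≤n
sum-bound {suc m} f b f≤b = +-mono-≤ (f≤b zero) (sum-bound (λ i → f (suc i)) b (λ i → f≤b (suc i)))

count : ∀ {n} → (Fin n → Bool) → ℕ
count P = sum (λ i → indicator (P i))

count-bound : ∀ {n} (P : Fin n → Bool) → count P ≤ n
count-bound {zero}  P = z≤n
count-bound {suc n} P = +-mono-≤ (indicator≤1 (P zero)) (count-bound (λ i → P (suc i)))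

count-strict : ∀ {n} (P Q : Fin n → Bool) → (∀ i → P i ≡ true → Q i ≡ true) →
               ∀ k → P k ≡ false → Q k ≡ true → count P < count Q
count-strict P Q P⊆Q k Pk Qk = sum-strict _ _ (λ i → indicator-mono (P⊆Q i)) k (indicator-strict Pk Qk)

Relᵇ : ℕ → Set
Relᵇ n = Fin n → Fin n → Bool

_⊆_ : ∀ {n} → Relᵇ n → Relᵇ n → Set
R ⊆ R′ = ∀ a c → R a c ≡ true → R′ a c ≡ true

size : ∀ {n} → Relᵇ n → ℕ
size R = sum (λ a → count (R a))

size-bound : ∀ {n} (R : Relᵇ n) → size R ≤ n * n
size-bound {n} R = sum-bound _ n (λ a → count-bound (R a))

size-strict : ∀ {n} {R R′ : Relᵇ n} → R ⊆ R′ → ∀ a c → R a c ≡ false → R′ a c ≡ true → size R < size R′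
size-strict {R = R} {R′} R⊆R′ a c Rac R′ac =
  sum-strict _ _ (λ a′ → sum-mono _ _ (λ c′ → indicator-mono (R⊆R′ a′ c′))) a
    (count-strict (R a) (R′ a) (R⊆R′ a) c Rac R′ac)

-- Since
-- every proper step adds a pair and there are only n * n pairs, the iteration
-- is stable after n * n + 1 rounds.
module Iteration {n} (step : Relᵇ n → Relᵇ n)
  (step-mono : ∀ {R R′} → R ⊆ R′ → step R ⊆ step R′)
  (step-infl : ∀ R → R ⊆ step R)
  (seed : Relᵇ n) where

  stage : ℕ → Relᵇ n
  stage zero    = seed
  stage (suc k) = step (stage k)

  Stable : ℕ → Set
  Stable k = stage (suc k) ⊆ stage k

  -- A round that does not increase the size adds nothing.
  stable-or-grows : ∀ k → Stable k ⊎ size (stage k) < size (stage (suc k))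
  stable-or-grows k with size (stage k) <? size (stage (suc k))
  ... | yes grows = inj₂ grows
  ... | no ¬grows = inj₁ unchanged
    where
    unchanged : Stable k
    unchanged a c new with stage k a c in old
    ... | true  = refl
    ... | false = ⊥-elim (¬grows (size-strict (step-infl (stage k)) a c old new))

  stable-or-large : ∀ k → Stable k ⊎ k ≤ size (stage k)
  stable-or-large zero = inj₂ z≤n
  stable-or-large (suc k) with stable-or-large k | stable-or-grows k
  ... | inj₁ stable | _            = inj₁ (step-mono stable)
  ... | inj₂ _      | inj₁ stable  = inj₁ (step-mono stable)
  ... | inj₂ large  | inj₂ grows   = inj₂ (≤-<-trans large grows)

  bound : ℕ
  bound = suc (n * n)

  closure : Relᵇ n
  closure = stage bound

  closure-closed : step closure ⊆ closure
  closure-closed with stable-or-large bound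
  ... | inj₁ stable = stable
  ... | inj₂ large  = ⊥-elim (n≮n (n * n) (≤-trans large (size-bound closure)))

  stage-mono : ∀ {k l} → k ≤′ l → stage k ⊆ stage l
  stage-mono ≤′-refl        = λ a c h → h
  stage-mono (≤′-step k≤l) = λ a c h → step-infl _ a c (stage-mono k≤l a c h)

  seed⊆closure : seed ⊆ closure
  seed⊆closure = stage-mono {0} {bound} (≤⇒≤′ z≤n)

  module _ (P : Fin n → Fin n → Set)
    (P-seed : ∀ a c → seed a c ≡ true → P a c)
    (P-step : ∀ {R} → R ⊆ closure → (∀ a c → R a c ≡ true → P a c) →
              ∀ a c → step R a c ≡ true → P a c) where

    private
      stage-ind : ∀ k → k ≤ bound → ∀ a c → stage k a c ≡ true → P a c
      stage-ind zero    _      = P-seed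
      stage-ind (suc k) k<bound =
        P-step (stage-mono {k} {bound} (≤⇒≤′ k≤bound)) (stage-ind k k≤bound)
        where k≤bound = ≤-trans (n≤1+n k) k<bound

    closure-ind : ∀ a c → closure a c ≡ true → P a c
    closure-ind = stage-ind bound ≤-refl

-- If ab and ac are edges while bc is not, then every
-- transitive orientation directs ab and ac both away from a or both towards
-- a: the orientation of ab forces that of ac.  The forcing closure of an edge
-- x₀y₀ is the least relation containing (x₀, y₀) that is closed under reversal
-- and forcing; it contains exactly the ordered pairs whose orientation is
-- tied to that of x₀y₀.
module Forcing {n} (X : Graph n) where

  data Reason (R : Relᵇ n) (a c : Fin n) : Set where
    kept     : R a c ≡ true → Reason R a c
    reversed : R c a ≡ true → Reason R a c
    forced   : ∀ b → R a b ≡ true → Edge X a c → adj X b c ≡ false → Reason R a c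

  force : Relᵇ n → Relᵇ n
  force R a c = R a c ∨ (R c a ∨ anyᵇ (λ b → R a b ∧ (adj X a c ∧ not (adj X b c))))

  force-sound : ∀ R a c → force R a c ≡ true → Reason R a c
  force-sound R a c h with ∨-elim (R a c) h
  ... | inj₁ Rac = kept Rac
  ... | inj₂ h′ with ∨-elim (R c a) h′
  ...   | inj₁ Rca = reversed Rca
  ...   | inj₂ h″ with anyᵇ-elim _ h″
  ...     | b , Rab∧… with ∧-elim (R a b) Rab∧…
  ...       | Rab , ac∧¬bc with ∧-elim (adj X a c) ac∧¬bc
  ...         | ac , ¬bc = forced b Rab ac (not-true ¬bc)

  force-complete : ∀ R {a c} → Reason R a c → force R a c ≡ true
  force-complete R (kept Rac) = ∨-introˡ _ Rac
  force-complete R {a} {c} (reversed Rca) = ∨-introʳ (R a c) (∨-introˡ _ Rca)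
  force-complete R {a} {c} (forced b Rab ac bc) =
    ∨-introʳ (R a c) (∨-introʳ (R c a)
      (anyᵇ-intro _ b (∧-intro Rab (∧-intro ac (cong not bc)))))

  force-mono : ∀ {R R′} → R ⊆ R′ → force R ⊆ force R′
  force-mono {R} {R′} R⊆R′ a c h with force-sound R a c h
  ... | kept Rac           = force-complete R′ (kept (R⊆R′ a c Rac))
  ... | reversed Rca       = force-complete R′ (reversed (R⊆R′ c a Rca))
  ... | forced b Rab ac bc = force-complete R′ (forced b (R⊆R′ a b Rab) ac bc)

  force-infl : ∀ R → R ⊆ force R
  force-infl R a c Rac = force-complete R (kept Rac)

  module Closure (x₀ y₀ : Fin n) (e₀ : Edge X x₀ y₀) where

    seed : Relᵇ n
    seed a c = does (a ≟ x₀) ∧ does (c ≟ y₀)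

    seed-elim : ∀ {a c} → seed a c ≡ true → a ≡ x₀ × c ≡ y₀
    seed-elim {a} {c} h with a ≟ x₀ | c ≟ y₀
    ... | yes a≡x₀ | yes c≡y₀ = a≡x₀ , c≡y₀

    open Iteration force force-mono force-infl seed
      using (closure; closure-closed; seed⊆closure; closure-ind)

    S : Relᵇ n
    S = closure

    S-seed : S x₀ y₀ ≡ true
    S-seed = seed⊆closure x₀ y₀ (∧-intro (dec-true (x₀ ≟ x₀) refl) (dec-true (y₀ ≟ y₀) refl))

    S-closed : ∀ {a c} → Reason S a c → S a c ≡ true
    S-closed r = closure-closed _ _ (force-complete S r)

    S-reverse : ∀ {a c} → S a c ≡ true → S c a ≡ true
    S-reverse Sac = S-closed (reversed Sac)

    S-force : ∀ {a b c} → S a b ≡ true → Edge X a c → adj X b c ≡ false → S a c ≡ true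
    S-force Sab ac bc = S-closed (forced _ Sab ac bc)

    S-edge : ∀ a c → S a c ≡ true → Edge X a c
    S-edge = closure-ind (Edge X) seed-edge step-edge
      where
      seed-edge : ∀ a c → seed a c ≡ true → Edge X a c
      seed-edge a c h with seed-elim {a} {c} h
      ... | refl , refl = e₀
      step-edge : ∀ {R} → R ⊆ S → (∀ a c → R a c ≡ true → Edge X a c) →
                  ∀ a c → force R a c ≡ true → Edge X a c
      step-edge {R} _ R-edge a c h with force-sound R a c h
      ... | kept Rac         = R-edge a c Rac
      ... | reversed Rca     = adj-flip X (R-edge c a Rca)
      ... | forced b _ ac _  = ac

    module _ (I : Fin n → Fin n → Set)
      (I-reverse : ∀ {a c} → S a c ≡ true → I a c → I c a)
      (I-force : ∀ {a b c} → S a b ≡ true → S a c ≡ true → adj X b c ≡ false → I a b → I a c) where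

      invariant : ∀ a c → S a c ≡ true → I a c ⇔ I x₀ y₀
      invariant = closure-ind (λ a c → I a c ⇔ I x₀ y₀) seed-case step-case
        where
        seed-case : ∀ a c → seed a c ≡ true → I a c ⇔ I x₀ y₀
        seed-case a c h with seed-elim {a} {c} h
        ... | refl , refl = ⇔-id _
        step-case : ∀ {R} → R ⊆ S → (∀ a c → R a c ≡ true → I a c ⇔ I x₀ y₀) →
                    ∀ a c → force R a c ≡ true → I a c ⇔ I x₀ y₀
        step-case {R} R⊆S ih a c h with force-sound R a c h
        ... | kept Rac     = ih a c Rac
        ... | reversed Rca = ih c a Rca ⇔-∘ mk⇔ (I-reverse Sac) (I-reverse (S-reverse Sac))
          where Sac = closure-closed a c (force-mono R⊆S a c h)
        ... | forced b Rab ac bc =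
          ih a b Rab ⇔-∘ mk⇔ (I-force Sac Sab (adj-flip X bc)) (I-force Sab Sac bc)
          where Sac = closure-closed a c (force-mono R⊆S a c h)
                Sab = R⊆S a b Rab

  -- A pair pq outside the closure of x₀y₀ forces only pairs outside it: lying
  -- outside that closure is invariant along the closure of pq.
  closure-avoids : ∀ {x₀ y₀ p q} (e₀ : Edge X x₀ y₀) (e : Edge X p q) →
    Closure.S x₀ y₀ e₀ p q ≡ false → ∀ a c → Closure.S p q e a c ≡ true → Closure.S x₀ y₀ e₀ a c ≡ false
  closure-avoids {x₀} {y₀} {p} {q} e₀ e pq∉S₀ a c Sac =
    Equivalence.from (Pq.invariant (λ a c → S₀.S a c ≡ false) outside-reverse outside-force a c Sac) pq∉S₀
    where
    module S₀ = Closure x₀ y₀ e₀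
    module Pq = Closure p q e
    outside-reverse : ∀ {a c} → Pq.S a c ≡ true → S₀.S a c ≡ false → S₀.S c a ≡ false
    outside-reverse _ ac∉S₀ = ¬-not (λ ca∈S₀ → clash (S₀.S-reverse ca∈S₀) ac∉S₀)
    outside-force : ∀ {a b c} → Pq.S a b ≡ true → Pq.S a c ≡ true → adj X b c ≡ false →
                    S₀.S a b ≡ false → S₀.S a c ≡ false
    outside-force {a} {b} Sab _ bc ab∉S₀ =
      ¬-not (λ ac∈S₀ → clash (S₀.S-force ac∈S₀ (Pq.S-edge a b Sab) (adj-flip X bc)) ab∉S₀)

-- The vertices touched by a closure form a module, hence (by
-- primality) all vertices; a pair outside the closure then produces a vertex
-- adjacent to both ends of a forced pair without being forced by either.
module PrimeForcing {n} (X : Graph n) (prime : IsPrime X) where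
  open Forcing X

  module _ {x₀ y₀ : Fin n} (e₀ : Edge X x₀ y₀) where
    open Closure x₀ y₀ e₀

    support : Fin n → Bool
    support v = anyᵇ (S v)

    outside-sees-alike : ∀ {v a b} → support v ≡ false → S a b ≡ true → adj X v a ≡ adj X v b
    outside-sees-alike {v} {a} {b} v∉ Sab with adj X v a in va | adj X v b in vb
    ... | true  | true  = refl
    ... | false | false = refl
    ... | true  | false = clash (anyᵇ-intro (S v) a
            (S-reverse (S-force Sab (adj-flip X va) (adj-flip X vb)))) v∉
    ... | false | true  = clash (anyᵇ-intro (S v) b
            (S-reverse (S-force (S-reverse Sab) (adj-flip X vb) (adj-flip X va)))) v∉

    -- The support is a module: by the invariance principle, a vertex outside
    -- it sees every vertex of the support as it sees x₀.
    support-isModule : IsModule X support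
    support-isModule v a b v∉ a∈ b∈ with anyᵇ-elim (S a) a∈ | anyᵇ-elim (S b) b∈
    ... | w , Saw | w′ , Sbw′ = trans (sees-like-x₀ a w Saw) (sym (sees-like-x₀ b w′ Sbw′))
      where
      SeenLikeX₀ : Fin n → Fin n → Set
      SeenLikeX₀ x y = adj X v x ≡ adj X v x₀ × adj X v y ≡ adj X v x₀
      sees-like-x₀ : ∀ x y → S x y ≡ true → adj X v x ≡ adj X v x₀
      sees-like-x₀ x y Sxy =
        proj₁ (Equivalence.from (invariant SeenLikeX₀ (λ _ (p , q) → q , p)
                 (λ _ Sxz _ (p , q) → p , trans (sym (outside-sees-alike v∉ Sxz)) p) x y Sxy)
               (refl , sym (outside-sees-alike v∉ S-seed)))

    -- By primality the support is everything (it contains both x₀ ≠ y₀).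
    support-full : ∀ v → support v ≡ true
    support-full with prime support support-isModule
    ... | inj₁ full       = full
    ... | inj₂ atMostOne  = ⊥-elim (clash (subst (λ x → Edge X x y₀) x₀≡y₀ e₀) (adj-irref X y₀))
      where
      x₀≡y₀ : x₀ ≡ y₀
      x₀≡y₀ = atMostOne x₀ y₀ (anyᵇ-intro (S x₀) y₀ S-seed) (anyᵇ-intro (S y₀) x₀ (S-reverse S-seed))

    -- No vertex a is adjacent to both ends of a forced pair bc while neither
    -- ab nor ac is forced: that property would propagate along the closure to
    -- a pair (a, w), making a adjacent to itself.
    no-unforced-fan : ∀ {a b c} → S b c ≡ true → Edge X a b → Edge X a c →
                      S a b ≡ false → S a c ≡ false → ⊥
    no-unforced-fan {a} {b} {c} Sbc ab ac ab∉ ac∉ with anyᵇ-elim (S a) (support-full a)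
    ... | w , Saw = clash (proj₁ (proj₁ unforced-aw)) (adj-irref X a)
      where
      UnforcedFrom-a : Fin n → Set
      UnforcedFrom-a x = Edge X a x × S a x ≡ false
      Unforced : Fin n → Fin n → Set
      Unforced x y = UnforcedFrom-a x × UnforcedFrom-a y
      exchange : ∀ {x y} → S x y ≡ true → Unforced x y → Unforced y x
      exchange _ (p , q) = q , p
      propagate : ∀ {x y z} → S x y ≡ true → S x z ≡ true → adj X y z ≡ false →
                  Unforced x y → Unforced x z
      propagate {x} {y} {z} _ Sxz yz ((ax , ax∉) , (ay , ay∉)) = (ax , ax∉) , (az , az∉)
        where
        az : Edge X a z
        az = ¬-not (λ az≡false → clash (S-reverse (S-force Sxz (adj-flip X ax)
                                                       (adj-flip X az≡false))) ax∉)
        az∉ : S a z ≡ false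
        az∉ = ¬-not (λ Saz → clash (S-force Saz ay (adj-flip X yz)) ay∉)
      unforced-invariant : ∀ x y → S x y ≡ true → Unforced x y ⇔ Unforced x₀ y₀
      unforced-invariant = invariant Unforced exchange propagate
      unforced-aw : Unforced a w
      unforced-aw = Equivalence.from (unforced-invariant a w Saw)
                      (Equivalence.to (unforced-invariant b c Sbc) ((ab , ab∉) , (ac , ac∉)))

  -- If pq is missing, take u with pu forced (p lies in the support).  Then uq
  -- is an edge (else pu would force pq); if qu is not forced, q is the apex of
  -- an unforced fan over pu; if it is, u is the apex of an unforced fan over
  -- pq within the closure of pq, which avoids the closure of x₀y₀.
  module _ {x₀ y₀ : Fin n} (e₀ : Edge X x₀ y₀) where
    open Closure x₀ y₀ e₀

    closure-complete : ∀ p q → Edge X p q → S p q ≡ true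
    closure-complete p q pq with S p q in pq∈ | anyᵇ-elim (S p) (support-full e₀ p)
    ... | true  | _ = refl
    ... | false | u , Spu with adj X u q in uq
    ...   | false = clash (S-force Spu pq uq) pq∈
    ...   | true with S q u in qu
    ...     | false = ⊥-elim $ no-unforced-fan e₀ Spu (adj-flip X pq) (adj-flip X uq)
                        (¬-not (λ Sqp → clash (S-reverse Sqp) pq∈)) qu
    ...     | true  = ⊥-elim $ no-unforced-fan pq (Closure.S-seed p q pq) (adj-flip X (S-edge p u Spu)) uq
                        (¬-not (λ Pup → clash (S-reverse Spu) (closure-avoids e₀ pq pq∈ u p Pup)))
                        (¬-not (λ Puq → clash (S-reverse qu) (closure-avoids e₀ pq pq∈ u q Puq)))

module Orientation {n} {X : Graph n} {O : Relᵇ n} (TO : IsTransitiveOrientation X O) where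

  O-edge : ∀ x y → O x y ≡ true → Edge X x y
  O-edge = proj₁ TO

  O-total : ∀ x y → Edge X x y → O x y ≡ true ⊎ O y x ≡ true
  O-total = proj₁ (proj₂ TO)

  O-asym : ∀ x y → O x y ≡ true → O y x ≡ true → ⊥
  O-asym = proj₁ (proj₂ (proj₂ TO))

  O-trans : ∀ x y z → O x y ≡ true → O y z ≡ true → O x z ≡ true
  O-trans = proj₂ (proj₂ (proj₂ TO))

  O-reverse : ∀ x y → Edge X x y → O y x ≡ not (O x y)
  O-reverse x y xy with O x y in xy↑ | O y x in yx↑
  ... | true  | true  = ⊥-elim (O-asym x y xy↑ yx↑)
  ... | true  | false = refl
  ... | false | true  = refl
  ... | false | false with O-total x y xy
  ...   | inj₁ xy↑′ = clash xy↑′ xy↑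
  ...   | inj₂ yx↑′ = clash yx↑′ yx↑

  O-forced : ∀ a b c → Edge X a b → Edge X a c → adj X b c ≡ false → O a b ≡ O a c
  O-forced a b c ab ac bc with O a b in ab↑ | O a c in ac↑
  ... | true  | true  = refl
  ... | false | false = refl
  ... | true  | false = clash (adj-flip X (O-edge c b (O-trans c a b ca↑ ab↑))) bc
    where ca↑ = trans (O-reverse a c ac) (cong not ac↑)
  ... | false | true  = clash (O-edge b c (O-trans b a c ba↑ ac↑)) bc
    where ba↑ = trans (O-reverse a b ab) (cong not ab↑)

  reversed : IsTransitiveOrientation X (λ x y → O y x)
  reversed = (λ x y yx↑ → adj-flip X (O-edge y x yx↑))
           , (λ x y xy → swap (O-total x y xy))
           , (λ x y yx↑ xy↑ → O-asym x y xy↑ yx↑)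
           , (λ x y z yx↑ zy↑ → O-trans z y x zy↑ yx↑)

  pulled-back : ∀ σ → IsAut X σ → IsTransitiveOrientation X (λ x y → O (σ ⟨$⟩ʳ x) (σ ⟨$⟩ʳ y))
  pulled-back σ σ-aut = (λ x y σxy↑ → trans (sym (σ-aut x y)) (O-edge _ _ σxy↑))
                      , (λ x y xy → O-total _ _ (trans (σ-aut x y) xy))
                      , (λ x y → O-asym _ _)
                      , (λ x y z → O-trans _ _ _)

-- The relation of orientation-unique holds at its reference edge.
xor-cancel : ∀ a b → a ≡ b xor (a xor b)
xor-cancel false false = refl
xor-cancel false true  = refl
xor-cancel true  false = refl
xor-cancel true  true  = refl

-- The relation "O′ a c ≡ O a c xor k" survives reversal and forcing, so it
-- spreads over the forcing closure of x₀y₀, which contains all edges.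
orientation-unique : ∀ {n} {X : Graph n} → IsPrime X → ∀ {O O′} →
  IsTransitiveOrientation X O → IsTransitiveOrientation X O′ →
  ∀ x₀ y₀ → Edge X x₀ y₀ → ∀ x y → Edge X x y → O′ x y ≡ O x y xor (O′ x₀ y₀ xor O x₀ y₀)
orientation-unique {n} {X} prime {O} {O′} TO TO′ x₀ y₀ e₀ x y xy =
  Equivalence.from (invariant Differ differ-reverse differ-force x y (closure-complete e₀ x y xy))
    (xor-cancel (O′ x₀ y₀) (O x₀ y₀))
  where
  open Forcing X
  open Closure x₀ y₀ e₀
  open PrimeForcing X prime using (closure-complete)
  module O = Orientation {X = X} {O} TO
  module O′ = Orientation {X = X} {O′} TO′
  k : Bool
  k = O′ x₀ y₀ xor O x₀ y₀
  Differ : Fin n → Fin n → Set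
  Differ a c = O′ a c ≡ O a c xor k
  differ-reverse : ∀ {a c} → S a c ≡ true → Differ a c → Differ c a
  differ-reverse {a} {c} Sac differ = begin
    O′ c a             ≡⟨ O′.O-reverse a c ac ⟩
    not (O′ a c)       ≡⟨ cong not differ ⟩
    not (O a c xor k)  ≡⟨ not-distribˡ-xor (O a c) k ⟩
    not (O a c) xor k  ≡⟨ cong (_xor k) (sym (O.O-reverse a c ac)) ⟩
    O c a xor k        ∎
    where ac = S-edge a c Sac
  differ-force : ∀ {a b c} → S a b ≡ true → S a c ≡ true → adj X b c ≡ false → Differ a b → Differ a c
  differ-force {a} {b} {c} Sab Sac bc differ = begin
    O′ a c       ≡⟨ sym (O′.O-forced a b c ab ac bc) ⟩
    O′ a b       ≡⟨ differ ⟩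
    O a b xor k  ≡⟨ cong (_xor k) (O.O-forced a b c ab ac bc) ⟩
    O a c xor k  ∎
    where ab = S-edge a b Sab
          ac = S-edge a c Sac

record ReversalCharacter {n} (X : Graph n) (O : Relᵇ n) : Set where
  field
    reverses      : Permutation′ n → Bool
    reverses-spec : ∀ σ → IsAut X σ → ∀ x y → Edge X x y →
                    O (σ ⟨$⟩ʳ x) (σ ⟨$⟩ʳ y) ≡ O x y xor reverses σ
    reverses-hom  : ∀ σ τ → IsAut X σ → IsAut X τ → reverses (σ ∘ₚ τ) ≡ reverses σ xor reverses τ

reversal-character : ∀ {n} {X : Graph n} → IsPrime X → ∀ {O} → IsTransitiveOrientation X O →
                     ReversalCharacter X O
reversal-character {n} {X} prime {O} TO with any? (λ x → any? (λ y → adj X x y ≟ᵇ true))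
... | no noEdge = record
  { reverses      = λ _ → false
  ; reverses-spec = λ _ _ x y xy → ⊥-elim (noEdge (x , y , xy))
  ; reverses-hom  = λ _ _ _ _ → refl
  }
... | yes (x₀ , y₀ , e₀) = record
  { reverses = reverses ; reverses-spec = reverses-spec ; reverses-hom = reverses-hom }
  where
  reverses : Permutation′ n → Bool
  reverses σ = O (σ ⟨$⟩ʳ x₀) (σ ⟨$⟩ʳ y₀) xor O x₀ y₀
  reverses-spec : ∀ σ → IsAut X σ → ∀ x y → Edge X x y → O (σ ⟨$⟩ʳ x) (σ ⟨$⟩ʳ y) ≡ O x y xor reverses σ
  reverses-spec σ σ-aut =
    orientation-unique {X = X} prime {O} {λ x y → O (σ ⟨$⟩ʳ x) (σ ⟨$⟩ʳ y)}
      TO (Orientation.pulled-back {X = X} TO σ σ-aut) x₀ y₀ e₀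
  reverses-hom : ∀ σ τ → IsAut X σ → IsAut X τ → reverses (σ ∘ₚ τ) ≡ reverses σ xor reverses τ
  reverses-hom σ τ σ-aut τ-aut = begin
    O (τ ⟨$⟩ʳ σx₀) (τ ⟨$⟩ʳ σy₀) xor O x₀ y₀        ≡⟨ cong (_xor O x₀ y₀) (reverses-spec τ τ-aut σx₀ σy₀ σe₀) ⟩
    (O σx₀ σy₀ xor reverses τ) xor O x₀ y₀        ≡⟨ xor-assoc (O σx₀ σy₀) (reverses τ) (O x₀ y₀) ⟩
    O σx₀ σy₀ xor (reverses τ xor O x₀ y₀)        ≡⟨ cong (O σx₀ σy₀ xor_) (xor-comm (reverses τ) (O x₀ y₀)) ⟩
    O σx₀ σy₀ xor (O x₀ y₀ xor reverses τ)        ≡⟨ sym (xor-assoc (O σx₀ σy₀) (O x₀ y₀) (reverses τ)) ⟩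
    reverses σ xor reverses τ                    ∎
    where σx₀ = σ ⟨$⟩ʳ x₀
          σy₀ = σ ⟨$⟩ʳ y₀
          σe₀ = trans (σ-aut x₀ y₀) e₀

-- The complement: adjacency is negated between distinct vertices, so it has
-- the same automorphisms and the same modules as X.
module _ {n} (X : Graph n) where

  complement-adj : ∀ {i j} → i ≢ j → adj (complement X) i j ≡ not (adj X i j)
  complement-adj {i} {j} i≢j with i ≟ j
  ... | yes i≡j = ⊥-elim (i≢j i≡j)
  ... | no  _   = refl

  complement-edge : ∀ {i j} → i ≢ j → adj X i j ≡ false → Edge (complement X) i j
  complement-edge i≢j ij = trans (complement-adj i≢j) (cong not ij)

  complement-nonadjacent : ∀ {i j} → Edge (complement X) i j → adj X i j ≡ false
  complement-nonadjacent {i} {j} ij = not-true (trans (sym (complement-adj i≢j)) ij)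
    where
    i≢j : i ≢ j
    i≢j refl = clash ij (adj-irref (complement X) i)

  complement-aut : ∀ σ → IsAut X σ → IsAut (complement X) σ
  complement-aut σ σ-aut i j = by-cases (i ≟ j)
    where
    permutation-injective : σ ⟨$⟩ʳ i ≡ σ ⟨$⟩ʳ j → i ≡ j
    permutation-injective σi≡σj = trans (sym (inverseˡ σ)) (trans (cong (σ ⟨$⟩ˡ_) σi≡σj) (inverseˡ σ))
    by-cases : Dec (i ≡ j) → adj (complement X) (σ ⟨$⟩ʳ i) (σ ⟨$⟩ʳ j) ≡ adj (complement X) i j
    by-cases (yes refl) = trans (adj-irref (complement X) (σ ⟨$⟩ʳ i)) (sym (adj-irref (complement X) i))
    by-cases (no i≢j)   = begin
      adj (complement X) (σ ⟨$⟩ʳ i) (σ ⟨$⟩ʳ j)  ≡⟨ complement-adj (i≢j ∘ permutation-injective) ⟩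
      not (adj X (σ ⟨$⟩ʳ i) (σ ⟨$⟩ʳ j))        ≡⟨ cong not (σ-aut i j) ⟩
      not (adj X i j)                          ≡⟨ sym (complement-adj i≢j) ⟩
      adj (complement X) i j                   ∎

  complement-prime : IsPrime X → IsPrime (complement X)
  complement-prime prime M M-module = prime M X-module
    where
    X-module : IsModule X M
    X-module v a b v∉ a∈ b∈ = not-injective (begin
      not (adj X v a)         ≡⟨ sym (complement-adj (λ { refl → clash a∈ v∉ })) ⟩
      adj (complement X) v a  ≡⟨ M-module v a b v∉ a∈ b∈ ⟩
      adj (complement X) v b  ≡⟨ complement-adj (λ { refl → clash b∈ v∉ }) ⟩
      not (adj X v b)         ∎)

-- Rigidity of finite linear orders: a permutation of Fin n preserving a
-- strict total order is the identity, because it preserves the rank of each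
-- element (the number of elements below it) and the rank is injective.
module Rigidity {n} (L : Relᵇ n)
  (L-irrefl : ∀ x → L x x ≡ false)
  (L-trans : ∀ x y z → L x y ≡ true → L y z ≡ true → L x z ≡ true)
  (L-connex : ∀ {x y} → x ≢ y → L x y ≡ true ⊎ L y x ≡ true) where

  rank : Fin n → ℕ
  rank u = count (λ w → L w u)

  rank-strict : ∀ {u v} → L u v ≡ true → rank u < rank v
  rank-strict {u} {v} uv = count-strict _ _ (λ w wu → L-trans w u v wu uv) u (L-irrefl u) uv

  module _ (π : Permutation′ n) (π-monotone : ∀ u v → L (π ⟨$⟩ʳ u) (π ⟨$⟩ʳ v) ≡ L u v) where

    rank-invariant : ∀ u → rank (π ⟨$⟩ʳ u) ≡ rank u
    rank-invariant u = begin
      count (λ w → L w (π ⟨$⟩ʳ u))               ≡⟨ sum-permute _ π ⟩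
      count (λ w → L (π ⟨$⟩ʳ w) (π ⟨$⟩ʳ u))      ≡⟨ sum-cong-≗ (λ w → cong indicator (π-monotone w u)) ⟩
      count (λ w → L w u)                        ∎

    order-automorphism-trivial : ∀ u → π ⟨$⟩ʳ u ≡ u
    order-automorphism-trivial u with π ⟨$⟩ʳ u ≟ u
    ... | yes fixed = fixed
    ... | no moved with L-connex moved
    ...   | inj₁ below = ⊥-elim (<-irrefl (rank-invariant u) (rank-strict below))
    ...   | inj₂ above = ⊥-elim (<-irrefl (sym (rank-invariant u)) (rank-strict above))

-- Mixed transitivity for transitive orientations O of X and P of its
-- complement: an O-arrow followed by a P-arrow is an arrow of O ∪ P.  A
-- returning arrow would make one of the two steps both an edge and a non-edge.
module MixedTransitivity {n} (X : Graph n) {O P : Relᵇ n}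
  (TO : IsTransitiveOrientation X O) (TP : IsTransitiveOrientation (complement X) P) where

  private
    module O = Orientation {X = X} TO
    module P = Orientation {X = complement X} TP

  O-then-P : ∀ x y z → O x y ≡ true → P y z ≡ true → O x z ∨ P x z ≡ true
  O-then-P x y z xy↑ yz↑ with adj X x z in xz
  ... | true with O.O-total x z xz
  ...   | inj₁ xz↑ = ∨-introˡ (P x z) xz↑
  ...   | inj₂ zx↑ = clash (adj-flip X (O.O-edge z y (O.O-trans z x y zx↑ xy↑)))
                           (complement-nonadjacent X (P.O-edge y z yz↑))
  O-then-P x y z xy↑ yz↑ | false with x ≟ z
  ... | yes refl = clash (adj-flip X (O.O-edge x y xy↑)) (complement-nonadjacent X (P.O-edge y x yz↑))
  ... | no x≢z with P.O-total x z (complement-edge X x≢z xz)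
  ...   | inj₁ xz↑ = ∨-introʳ (O x z) xz↑
  ...   | inj₂ zx↑ = clash (adj-flip X (O.O-edge x y xy↑))
                           (complement-nonadjacent X (P.O-edge y x (P.O-trans y z x yz↑ zx↑)))

-- If O orients X and P orients its
-- complement transitively, then O ∪ P is a strict total order on the vertices
-- (in the segment model: the left-to-right order of the endpoints on one line).
module PermutationOrder {n} (X : Graph n) {O P : Relᵇ n}
  (TO : IsTransitiveOrientation X O) (TP : IsTransitiveOrientation (complement X) P) where

  private
    module O = Orientation {X = X} TO
    module P = Orientation {X = complement X} TP

  L : Relᵇ n
  L x y = O x y ∨ P x y

  L-irrefl : ∀ x → L x x ≡ false
  L-irrefl x with O x x in xx↑ | P x x in xx↑′
  ... | true  | _     = clash (O.O-edge x x xx↑) (adj-irref X x)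
  ... | false | true  = clash (P.O-edge x x xx↑′) (adj-irref (complement X) x)
  ... | false | false = refl

  -- Distinct vertices are adjacent in X or in its complement, and oriented there.
  L-connex : ∀ {x y} → x ≢ y → L x y ≡ true ⊎ L y x ≡ true
  L-connex {x} {y} x≢y with adj X x y in xy
  ... | true with O.O-total x y xy
  ...   | inj₁ xy↑ = inj₁ (∨-introˡ (P x y) xy↑)
  ...   | inj₂ yx↑ = inj₂ (∨-introˡ (P y x) yx↑)
  L-connex {x} {y} x≢y | false with P.O-total x y (complement-edge X x≢y xy)
  ...   | inj₁ xy↑ = inj₁ (∨-introʳ (O x y) xy↑)
  ...   | inj₂ yx↑ = inj₂ (∨-introʳ (O y x) yx↑)

  L-on-edge : ∀ {x y} → Edge X x y → L x y ≡ O x y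
  L-on-edge {x} {y} xy with P x y in xy↑
  ... | false = ∨-identityʳ (O x y)
  ... | true  = clash xy (complement-nonadjacent X (P.O-edge x y xy↑))

  L-on-non-edge : ∀ {x y} → adj X x y ≡ false → L x y ≡ P x y
  L-on-non-edge {x} {y} xy with O x y in xy↑
  ... | false = refl
  ... | true  = clash (O.O-edge x y xy↑) xy

  -- The P-then-O case is mixed transitivity for the reversed orientations.
  L-trans : ∀ x y z → L x y ≡ true → L y z ≡ true → L x z ≡ true
  L-trans x y z xy↑ yz↑ with ∨-elim (O x y) xy↑ | ∨-elim (O y z) yz↑
  ... | inj₁ O-xy | inj₁ O-yz = ∨-introˡ (P x z) (O.O-trans x y z O-xy O-yz)
  ... | inj₂ P-xy | inj₂ P-yz = ∨-introʳ (O x z) (P.O-trans x y z P-xy P-yz)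
  ... | inj₁ O-xy | inj₂ P-yz = MixedTransitivity.O-then-P X TO TP x y z O-xy P-yz
  ... | inj₂ P-xy | inj₁ O-yz = MixedTransitivity.O-then-P X O.reversed P.reversed z y x O-yz P-xy

-- An automorphism σ carries two
-- bits: whether it reverses O and whether it reverses P.  These bits determine
-- the image of the order L = O ∪ P under σ, and by rigidity of L they
-- determine σ itself.
module PrimePermutationGraph {n} (X : Graph n) (prime : IsPrime X) {O P : Relᵇ n}
  (TO : IsTransitiveOrientation X O) (TP : IsTransitiveOrientation (complement X) P) where

  private
    module χ₁ = ReversalCharacter (reversal-character {X = X} prime TO)
    module χ₂ = ReversalCharacter (reversal-character {X = complement X} (complement-prime X prime) TP)
  open PermutationOrder X TO TP
  open Rigidity L L-irrefl L-trans L-connex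

  characters : Aut X → Z₂²
  characters (σ , _) = χ₁.reverses σ , χ₂.reverses σ

  characters-hom : ∀ σ τ → characters (_∘ᴬ_ {X = X} σ τ) ≡ characters σ ⊕ characters τ
  characters-hom (σ , σ-aut) (τ , τ-aut) =
    cong₂ _,_ (χ₁.reverses-hom σ τ σ-aut τ-aut)
              (χ₂.reverses-hom σ τ (complement-aut X σ σ-aut) (complement-aut X τ τ-aut))

  same-image-of-order : ∀ σ τ → characters σ ≡ characters τ → ∀ u v →
    L (proj₁ σ ⟨$⟩ʳ u) (proj₁ σ ⟨$⟩ʳ v) ≡ L (proj₁ τ ⟨$⟩ʳ u) (proj₁ τ ⟨$⟩ʳ v)
  same-image-of-order (σ , σ-aut) (τ , τ-aut) same u v with u ≟ v
  ... | yes refl = trans (L-irrefl _) (sym (L-irrefl _))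
  ... | no u≢v with adj X u v in uv
  ...   | true  = begin
    L (σ ⟨$⟩ʳ u) (σ ⟨$⟩ʳ v)      ≡⟨ L-on-edge (trans (σ-aut u v) uv) ⟩
    O (σ ⟨$⟩ʳ u) (σ ⟨$⟩ʳ v)      ≡⟨ χ₁.reverses-spec σ σ-aut u v uv ⟩
    O u v xor χ₁.reverses σ      ≡⟨ cong (O u v xor_) (cong proj₁ same) ⟩
    O u v xor χ₁.reverses τ      ≡⟨ sym (χ₁.reverses-spec τ τ-aut u v uv) ⟩
    O (τ ⟨$⟩ʳ u) (τ ⟨$⟩ʳ v)      ≡⟨ sym (L-on-edge (trans (τ-aut u v) uv)) ⟩
    L (τ ⟨$⟩ʳ u) (τ ⟨$⟩ʳ v)      ∎
  ...   | false = begin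
    L (σ ⟨$⟩ʳ u) (σ ⟨$⟩ʳ v)      ≡⟨ L-on-non-edge (trans (σ-aut u v) uv) ⟩
    P (σ ⟨$⟩ʳ u) (σ ⟨$⟩ʳ v)      ≡⟨ χ₂.reverses-spec σ (complement-aut X σ σ-aut) u v uv′ ⟩
    P u v xor χ₂.reverses σ      ≡⟨ cong (P u v xor_) (cong proj₂ same) ⟩
    P u v xor χ₂.reverses τ      ≡⟨ sym (χ₂.reverses-spec τ (complement-aut X τ τ-aut) u v uv′) ⟩
    P (τ ⟨$⟩ʳ u) (τ ⟨$⟩ʳ v)      ≡⟨ sym (L-on-non-edge (trans (τ-aut u v) uv)) ⟩
    L (τ ⟨$⟩ʳ u) (τ ⟨$⟩ʳ v)      ∎
    where uv′ = complement-edge X u≢v uv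

  -- Then σ⁻¹ followed by τ preserves L, hence is the identity.
  characters-injective : ∀ σ τ → characters σ ≡ characters τ → ∀ i → proj₁ σ ⟨$⟩ʳ i ≡ proj₁ τ ⟨$⟩ʳ i
  characters-injective σ̂@(σ , _) τ̂@(τ , _) same i = begin
    σ ⟨$⟩ʳ i                        ≡⟨ sym (order-automorphism-trivial π π-monotone (σ ⟨$⟩ʳ i)) ⟩
    τ ⟨$⟩ʳ (σ ⟨$⟩ˡ (σ ⟨$⟩ʳ i))      ≡⟨ cong (τ ⟨$⟩ʳ_) (inverseˡ σ) ⟩
    τ ⟨$⟩ʳ i                        ∎
    where
    π : Permutation′ n
    π = flip σ ∘ₚ τ
    π-monotone : ∀ u v → L (π ⟨$⟩ʳ u) (π ⟨$⟩ʳ v) ≡ L u v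
    π-monotone u v = begin
      L (τ ⟨$⟩ʳ (σ ⟨$⟩ˡ u)) (τ ⟨$⟩ʳ (σ ⟨$⟩ˡ v))   ≡⟨ sym (same-image-of-order σ̂ τ̂ same (σ ⟨$⟩ˡ u) (σ ⟨$⟩ˡ v)) ⟩
      L (σ ⟨$⟩ʳ (σ ⟨$⟩ˡ u)) (σ ⟨$⟩ʳ (σ ⟨$⟩ˡ v))   ≡⟨ cong₂ L (inverseʳ σ) (inverseʳ σ) ⟩
      L u v                                     ∎

mainTheorem5 : ∀ (n : ℕ) (X : Graph n) → IsPermutationGraph X → IsPrime X → AutEmbedsInZ₂² X
mainTheorem5 n X ((O , TO) , (P , TP)) prime = characters , characters-hom , characters-injective
  where open PrimePermutationGraph X prime TO TP
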